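{- For every integer $m\geq 8$, the graph $G(m)$ does not belong to the class $\mathfrak{M}$; that is, for no positive integer $t$ does $G(m)$ admit a cyclically-interval $t$-coloring.
   Context: All graphs are undirected, simple, finite and connected. For integers $p\le q$, $[p,q]$ denotes the set of integers from $p$ to $q$; an interval is a nonempty set of consecutive integers. A function $\varphi:E(G)\to[1,t]$ is a proper edge $t$-coloring of a graph $G$ if adjacent edges receive different colors and each of the $t$ colors is used. For a vertex $x$, $S_G(x,\varphi)$ denotes the set of colors of edges incident with $x$. A proper edge $t$-coloring $\varphi$ of $G$ is a cyclically-interval $t$-coloring if for every vertex $x\in V(G)$ at least one of the following holds: (a) $S_G(x,\varphi)$ is an interval; (b) $[1,t]\setminus S_G(x,\varphi)$ is an interval. $\mathfrak{M}_t$ is the set of graphs admitting a cyclically-interval $t$-coloring, and $\mathfrak{M}=\bigcup_{t\ge1}\mathfrak{M}_t$. For an integer $m\geq 2$, the graph $G(m)$ is defined as follows. Its vertex set is $\{x_0\}\cup\{x_{i,j}: 1\le i<j\le m\}\cup\{y_{p,q}: 1\le p\le m,\ 1\le q\le m\}$ (all distinct). Its edge set consists of the edges $(x_0,y_{p,q})$ for all $1\le p,q\le m$, together with, for each pair $1\le i<j\le m$, the edges $(x_{i,j},y_{i,q})$ and $(x_{i,j},y_{j,q})$ for all $1\le q\le m$. -}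

module Defs where

open import Data.Nat using (ℕ; _≤_)
open import Data.Fin using (Fin) renaming (_<_ to _<ᶠ_)
open import Data.Product using (Σ; _×_; _,_; proj₁; proj₂; ∃)
open import Data.Sum using (_⊎_)
open import Relation.Binary.PropositionalEquality using (_≡_)
open import Relation.Nullary using (¬_)

record Graph : Set₁ where
  field
    V    : Set
    E    : Set
    ends : E → V × V

open Graph public

Incident : (G : Graph) → V G → E G → Set
Incident G x e = proj₁ (ends G e) ≡ x ⊎ proj₂ (ends G e) ≡ x

InRange : ℕ → ℕ → ℕ → Set
InRange p q c = p ≤ c × c ≤ q

IsProperEdgeColoring : (G : Graph) → ℕ → (E G → ℕ) → Set
IsProperEdgeColoring G t φ =
  (∀ e → InRange 1 t (φ e))
  × (∀ x e e′ → Incident G x e → Incident G x e′ → φ e ≡ φ e′ → e ≡ e′)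
  × (∀ c → InRange 1 t c → ∃ λ e → φ e ≡ c)

InS : (G : Graph) → (E G → ℕ) → V G → ℕ → Set
InS G φ x c = ∃ λ e → Incident G x e × φ e ≡ c

IsInterval : (ℕ → Set) → Set
IsInterval P = ∃ λ a → ∃ λ b → a ≤ b × (∀ c → (P c → InRange a b c) × (InRange a b c → P c))

IsCyclicallyIntervalColoring : (G : Graph) → ℕ → (E G → ℕ) → Set
IsCyclicallyIntervalColoring G t φ =
  IsProperEdgeColoring G t φ
  × (∀ x → IsInterval (InS G φ x)
           ⊎ IsInterval (λ c → InRange 1 t c × ¬ InS G φ x c))

InMt : Graph → ℕ → Set
InMt G t = Σ (E G → ℕ) λ φ → IsCyclicallyIntervalColoring G t φ

InM : Graph → Set
InM G = ∃ λ t → 1 ≤ t × InMt G t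

-- The graph G(m).  Indices 1..m are represented by Fin m (0..m-1).
data VG (m : ℕ) : Set where
  x₀ : VG m
  x  : (i j : Fin m) → i <ᶠ j → VG m
  y  : (p q : Fin m) → VG m

data EG (m : ℕ) : Set where
  e₀ : (p q : Fin m) → EG m
  eᵢ : (i j : Fin m) → i <ᶠ j → (q : Fin m) → EG m
  eⱼ : (i j : Fin m) → i <ᶠ j → (q : Fin m) → EG m

endsG : (m : ℕ) → EG m → VG m × VG m
endsG m (e₀ p q)       = x₀ , y p q
endsG m (eᵢ i j i<j q) = x i j i<j , y i q
endsG m (eⱼ i j i<j q) = x i j i<j , y j q

G : ℕ → Graph
G m = record { V = VG m ; E = EG m ; ends = endsG m }

-- In a cyclically-interval t-colouring the colours at a vertex of degree d form an arc of
-- the cycle ℤ/tℤ, so any two of them are at cyclic distance at most d − 1. In G(m) the edge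
-- x₀y_{p,q} is joined to x₀y_{1,1} through y_{1,1}, x_{1,j} and y_{p,q}, of degrees m, 2m
-- and m; hence the m² distinct colours at x₀ lie within cyclic distance 4m − 3 of a single
-- colour, i.e. among 8m − 5 residues mod t. So m² ≤ 8m − 5, which fails for m ≥ 8.

module Submission where

open import Defs
open import Data.Nat using (ℕ; zero; suc; _+_; _∸_; _*_; _≤_; _<_; z≤n; s≤s; s≤s⁻¹; _≤?_; _<?_)
open import Data.Nat.Properties
  using (≤-trans; <-≤-trans; ≤-<-trans; <⇒≱; ≮⇒≥; ≰⇒>; ≤-total; +-mono-≤; +-monoˡ-≤; +-suc;
         m≤m+n; m+[n∸m]≡n; *-monoˡ-≤; +-monoʳ-<; +-monoʳ-≤; +-cancelˡ-≡; <⇒≢)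
import Data.Nat.Tactic.RingSolver as ℕ-Solver
open import Data.Integer as Z using (ℤ; +_; -[1+_]; ∣_∣; +≤+; 0ℤ)
open import Data.Integer.Properties
  using (∣i+j∣≤∣i∣+∣j∣; ∣-i∣≡∣i∣; 0≤i⇒+∣i∣≡i; +-injective; +-identityʳ; pos-+; pos-*; ⊖-≥)
open import Data.Integer.Tactic.RingSolver using (solve-∀)
import Data.Fin as Fin
open import Data.Fin using (Fin; toℕ; fromℕ<; splitAt; join; remQuot) renaming (_<_ to _<ᶠ_)
open import Data.Fin.Properties using (toℕ<n; toℕ-injective; toℕ-fromℕ<; injective⇒≤; <-irrelevant; +↔⊎; *↔×)
  renaming (<⇒≢ to <ᶠ⇒≢; <-asym to <ᶠ-asym)
open import Data.Product using (_×_; _,_; proj₁; proj₂; uncurry)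
open import Data.Sum using (_⊎_; inj₁; inj₂)
open import Data.Empty using (⊥-elim)
open import Function using (_∘_)
open import Function.Definitions using (Injective)
open import Function.Bundles using (Injection)
open import Function.Properties.Inverse using (↔⇒↣; ↔-sym)
open import Relation.Nullary using (¬_; Dec; yes; no)
open import Relation.Nullary.Decidable using (decidable-stable)
open import Relation.Binary.PropositionalEquality

open ≡-Reasoning

variable
  t r s a b c c′ c₁ c₂ d u₁ u₂ n₁ n₂ : ℕ
  S : ℕ → Set

-- c′ ≡ c + offset (mod t): c and c′ are at distance at most r on the cycle ℤ/tℤ.
record Near (t r c c′ : ℕ) : Set where
  constructor near
  field
    offset     : ℤ
    winding    : ℤ
    ∣offset∣≤r : ∣ offset ∣ ≤ r
    congruence : + c′ ≡ + c Z.+ offset Z.+ winding Z.* + t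

open Near

near-sym : Near t r c c′ → Near t r c′ c
near-sym {t = t} {c = c} {c′ = c′} (near k n ∣k∣≤r c′≡) =
  near (Z.- k) (Z.- n) (subst (_≤ _) (sym (∣-i∣≡∣i∣ k)) ∣k∣≤r) (begin
    + c                                            ≡⟨ undo (+ c) k n (+ t) ⟩
    + c Z.+ k Z.+ n Z.* + t Z.+ Z.- k Z.+ Z.- n Z.* + t ≡⟨ cong (λ w → w Z.+ Z.- k Z.+ Z.- n Z.* + t) c′≡ ⟨
    + c′ Z.+ Z.- k Z.+ Z.- n Z.* + t               ∎)
  where
  undo : ∀ c k n t → c ≡ c Z.+ k Z.+ n Z.* t Z.+ Z.- k Z.+ Z.- n Z.* t
  undo = solve-∀

near-trans : Near t r a b → Near t s b c → Near t (r + s) a c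
near-trans {t} {a = a} {b = b} {c = c} (near k n ∣k∣≤r b≡) (near k′ n′ ∣k′∣≤s c≡) =
  near (k Z.+ k′) (n Z.+ n′) (≤-trans (∣i+j∣≤∣i∣+∣j∣ k k′) (+-mono-≤ ∣k∣≤r ∣k′∣≤s)) (begin
    + c                                           ≡⟨ c≡ ⟩
    + b Z.+ k′ Z.+ n′ Z.* + t                     ≡⟨ cong (λ w → w Z.+ k′ Z.+ n′ Z.* + t) b≡ ⟩
    + a Z.+ k Z.+ n Z.* + t Z.+ k′ Z.+ n′ Z.* + t ≡⟨ regroup (+ a) k n k′ n′ (+ t) ⟩
    + a Z.+ (k Z.+ k′) Z.+ (n Z.+ n′) Z.* + t     ∎)
  where
  regroup : ∀ a k n k′ n′ t → a Z.+ k Z.+ n Z.* t Z.+ k′ Z.+ n′ Z.* t ≡ a Z.+ (k Z.+ k′) Z.+ (n Z.+ n′) Z.* t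
  regroup = solve-∀

near-≤ : c ≤ c′ → c′ ∸ c ≤ r → Near t r c c′
near-≤ {c = c} {c′ = c′} {t = t} c≤c′ c′∸c≤r = near (+ (c′ ∸ c)) (+ 0) c′∸c≤r (begin
  + c′                                   ≡⟨ cong +_ (m+[n∸m]≡n c≤c′) ⟨
  + (c + (c′ ∸ c))                       ≡⟨ pos-+ c (c′ ∸ c) ⟩
  + c Z.+ + (c′ ∸ c)                     ≡⟨ +-identityʳ _ ⟨
  + c Z.+ + (c′ ∸ c) Z.+ + 0 Z.* + t     ∎)

near-wrap : c′ ≤ t → c + (t ∸ c′) ≤ r → Near t r c c′
near-wrap {c′ = c′} {t = t} {c = c} c′≤t δ≤r =
  near (Z.- + δ) (+ 1) (subst (_≤ _) (sym (∣-i∣≡∣i∣ (+ δ))) δ≤r) (begin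
  + c′                              ≡⟨ shift (+ c′) (+ δ) ⟩
  + c′ Z.+ + δ Z.+ Z.- + δ          ≡⟨ cong (λ w → w Z.+ Z.- + δ) (pos-+ c′ δ) ⟨
  + (c′ + δ) Z.+ Z.- + δ            ≡⟨ cong (λ w → + w Z.+ Z.- + δ) c′+δ≡c+t ⟩
  + (c + t) Z.+ Z.- + δ             ≡⟨ cong (λ w → w Z.+ Z.- + δ) (pos-+ c t) ⟩
  + c Z.+ + t Z.+ Z.- + δ           ≡⟨ wind (+ c) (+ δ) (+ t) ⟩
  + c Z.+ Z.- + δ Z.+ + 1 Z.* + t   ∎)
  where
  δ : ℕ
  δ = c + (t ∸ c′)
  swap : ∀ a b c → a + (b + c) ≡ b + (a + c)
  swap = ℕ-Solver.solve-∀
  c′+δ≡c+t : c′ + δ ≡ c + t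
  c′+δ≡c+t = begin
    c′ + (c + (t ∸ c′))  ≡⟨ swap c′ c (t ∸ c′) ⟩
    c + (c′ + (t ∸ c′))  ≡⟨ cong (λ w → c + w) (m+[n∸m]≡n c′≤t) ⟩
    c + t                ∎
  shift : ∀ c′ δ → c′ ≡ c′ Z.+ δ Z.+ Z.- δ
  shift = solve-∀
  wind : ∀ c δ t → c Z.+ t Z.+ Z.- δ ≡ c Z.+ Z.- δ Z.+ + 1 Z.* t
  wind = solve-∀

no-forward-winding : ∀ {u v t} w → 1 ≤ v → u ≤ t → + u ≢ + v Z.+ + suc w Z.* + t
no-forward-winding {u} {v} {t} w 1≤v u≤t u≡ = <⇒≱ t<u u≤t
  where
  u≡v+[1+w]t : u ≡ v + suc w * t
  u≡v+[1+w]t = +-injective (begin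
    + u                       ≡⟨ u≡ ⟩
    + v Z.+ + suc w Z.* + t   ≡⟨ cong (λ z → + v Z.+ z) (pos-* (suc w) t) ⟨
    + v Z.+ + (suc w * t)     ≡⟨ pos-+ v (suc w * t) ⟨
    + (v + suc w * t)         ∎)
  t<u : t < u
  t<u = subst (t <_) (sym u≡v+[1+w]t) (+-mono-≤ 1≤v (m≤m+n t (w * t)))

congruent⇒≡ : ∀ {u v t} → InRange 1 t u → InRange 1 t v → ∀ w → + u ≡ + v Z.+ w Z.* + t → u ≡ v
congruent⇒≡ {v = v} _ _ (+ 0) u≡ = +-injective (trans u≡ (+-identityʳ (+ v)))
congruent⇒≡ (_ , u≤t) (1≤v , _) (+ suc w) u≡ = ⊥-elim (no-forward-winding w 1≤v u≤t u≡)
congruent⇒≡ {u} {v} {t} (1≤u , _) (_ , v≤t) -[1+ w ] u≡ =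
  ⊥-elim (no-forward-winding w 1≤u v≤t (unwind (+ u) (+ v) (+ suc w) (+ t) u≡))
  where
  unwind : ∀ u v w t → u ≡ v Z.+ Z.- w Z.* t → v ≡ u Z.+ w Z.* t
  unwind u v w t u≡ = begin
    v                               ≡⟨ cancel v w t ⟩
    v Z.+ Z.- w Z.* t Z.+ w Z.* t   ≡⟨ cong (λ z → z Z.+ w Z.* t) u≡ ⟨
    u Z.+ w Z.* t                   ∎
    where
    cancel : ∀ v w t → v ≡ v Z.+ Z.- w Z.* t Z.+ w Z.* t
    cancel = solve-∀

-- Offsets k with ∣ k ∣ ≤ r, indexed by k + r ∈ [0, 2r].
offset-index : ∀ {r} (k : ℤ) → ∣ k ∣ ≤ r → Fin (suc (r + r))
offset-index {r} k ∣k∣≤r = fromℕ< (s≤s (≤-trans (∣i+j∣≤∣i∣+∣j∣ k (+ r)) (+-monoˡ-≤ r ∣k∣≤r)))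

0≤k+r : ∀ {r} k → ∣ k ∣ ≤ r → 0ℤ Z.≤ k Z.+ + r
0≤k+r (+ a)    _   = subst (0ℤ Z.≤_) (pos-+ a _) (+≤+ z≤n)
0≤k+r -[1+ a ] a<r = subst (0ℤ Z.≤_) (sym (⊖-≥ a<r)) (+≤+ z≤n)

offset-index-injective : ∀ {r k k′} (p : ∣ k ∣ ≤ r) (p′ : ∣ k′ ∣ ≤ r) →
                         offset-index k p ≡ offset-index k′ p′ → k ≡ k′
offset-index-injective {r} {k} {k′} p p′ eq = begin
  k                    ≡⟨ cancel k (+ r) ⟩
  k Z.+ + r Z.- + r    ≡⟨ cong (Z._- + r) k+r≡k′+r ⟩
  k′ Z.+ + r Z.- + r   ≡⟨ cancel k′ (+ r) ⟨
  k′                   ∎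
  where
  cancel : ∀ k r → k ≡ k Z.+ r Z.- r
  cancel = solve-∀
  ∣k+r∣≡∣k′+r∣ : ∣ k Z.+ + r ∣ ≡ ∣ k′ Z.+ + r ∣
  ∣k+r∣≡∣k′+r∣ = trans (sym (toℕ-fromℕ< _)) (trans (cong toℕ eq) (toℕ-fromℕ< _))
  k+r≡k′+r : k Z.+ + r ≡ k′ Z.+ + r
  k+r≡k′+r = begin
    k Z.+ + r           ≡⟨ 0≤i⇒+∣i∣≡i (0≤k+r k p) ⟨
    + ∣ k Z.+ + r ∣     ≡⟨ cong +_ ∣k+r∣≡∣k′+r∣ ⟩
    + ∣ k′ Z.+ + r ∣    ≡⟨ 0≤i⇒+∣i∣≡i (0≤k+r k′ p′) ⟩
    k′ Z.+ + r          ∎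

offset-injective : InRange 1 t c₁ → InRange 1 t c₂ → (p : Near t r c c₁) (q : Near t r c c₂) →
                   offset p ≡ offset q → c₁ ≡ c₂
offset-injective {t = t} {c₁ = c₁} {c₂ = c₂} {c = c} c₁∈ c₂∈ (near k n _ c₁≡) (near k n′ _ c₂≡) refl =
  congruent⇒≡ c₁∈ c₂∈ (n Z.- n′) (begin
    + c₁                                            ≡⟨ c₁≡ ⟩
    + c Z.+ k Z.+ n Z.* + t                         ≡⟨ rewind (+ c Z.+ k) n n′ (+ t) ⟩
    + c Z.+ k Z.+ n′ Z.* + t Z.+ (n Z.- n′) Z.* + t ≡⟨ cong (λ z → z Z.+ (n Z.- n′) Z.* + t) c₂≡ ⟨
    + c₂ Z.+ (n Z.- n′) Z.* + t                     ∎)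
  where
  rewind : ∀ x n n′ t → x Z.+ n Z.* t ≡ x Z.+ n′ Z.* t Z.+ (n Z.- n′) Z.* t
  rewind = solve-∀

near-pigeonhole : ∀ {n} (f : Fin n → ℕ) → Injective _≡_ _≡_ f → (∀ i → InRange 1 t (f i)) →
                  (∀ i → Near t r c (f i)) → n ≤ suc (r + r)
near-pigeonhole f f-injective f∈ f-near = injective⇒≤ λ {i} {j} eq →
  f-injective (offset-injective (f∈ i) (f∈ j) (f-near i) (f-near j)
    (offset-index-injective (∣offset∣≤r (f-near i)) (∣offset∣≤r (f-near j)) eq))

-- Membership is only asked up to double negation: the co-interval case yields no more.
HasAtMost : ℕ → (ℕ → Set) → Set
HasAtMost d S = ∀ {n} (g : Fin n → ℕ) → Injective _≡_ _≡_ g → (∀ i → ¬ ¬ S (g i)) → n ≤ d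

¬¬-Π-Fin : ∀ n {P : Fin n → Set} → (∀ i → ¬ ¬ P i) → ¬ ¬ (∀ i → P i)
¬¬-Π-Fin zero    _   k = k λ ()
¬¬-Π-Fin (suc n) ¬¬P k = ¬¬P Fin.zero λ P₀ → ¬¬-Π-Fin n (¬¬P ∘ Fin.suc) λ Pₛ →
  k λ { Fin.zero → P₀ ; (Fin.suc i) → Pₛ i }

segments-≤ : HasAtMost d S → u₁ + n₁ ≤ u₂ → (∀ (i : Fin n₁) → ¬ ¬ S (u₁ + toℕ i)) →
             (∀ (i : Fin n₂) → ¬ ¬ S (u₂ + toℕ i)) → n₁ + n₂ ≤ d
segments-≤ {S = S} {u₁ = u₁} {n₁ = n₁} {u₂ = u₂} {n₂ = n₂} few u₁+n₁≤u₂ S₁ S₂ =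
  few (g ∘ splitAt n₁) (λ eq → Injection.injective (↔⇒↣ +↔⊎) (g-injective eq)) (g∈S ∘ splitAt n₁)
  where
  g : Fin n₁ ⊎ Fin n₂ → ℕ
  g (inj₁ i) = u₁ + toℕ i
  g (inj₂ i) = u₂ + toℕ i
  first<second : ∀ i j → u₁ + toℕ i < u₂ + toℕ j
  first<second i j = <-≤-trans (+-monoʳ-< u₁ (toℕ<n i)) (≤-trans u₁+n₁≤u₂ (m≤m+n u₂ (toℕ j)))
  g-injective : Injective _≡_ _≡_ g
  g-injective {inj₁ i} {inj₁ j} eq = cong inj₁ (toℕ-injective (+-cancelˡ-≡ u₁ _ _ eq))
  g-injective {inj₂ i} {inj₂ j} eq = cong inj₂ (toℕ-injective (+-cancelˡ-≡ u₂ _ _ eq))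
  g-injective {inj₁ i} {inj₂ j} eq = ⊥-elim (<⇒≢ (first<second i j) eq)
  g-injective {inj₂ i} {inj₁ j} eq = ⊥-elim (<⇒≢ (first<second j i) (sym eq))
  g∈S : ∀ p → ¬ ¬ S (g p)
  g∈S (inj₁ i) = S₁ i
  g∈S (inj₂ i) = S₂ i

range⇒segment : ∀ {u w} {P : ℕ → Set} → u ≤ w → (∀ z → u ≤ z → z ≤ w → P z) →
                ∀ (i : Fin (suc (w ∸ u))) → P (u + toℕ i)
range⇒segment {u} u≤w P-range i =
  P-range _ (m≤m+n u (toℕ i)) (subst (u + toℕ i ≤_) (m+[n∸m]≡n u≤w) (+-monoʳ-≤ u (s≤s⁻¹ (toℕ<n i))))

segment-length : ∀ {u w} → HasAtMost (suc r) S → u ≤ w → (∀ z → u ≤ z → z ≤ w → ¬ ¬ S z) → w ∸ u ≤ r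
segment-length {S = S} few u≤w S-range = s≤s⁻¹ (segments-≤ {S = S} {u₁ = 0} few z≤n (λ ()) (range⇒segment u≤w S-range))

wrap-length : HasAtMost (suc r) S → c < c′ → c′ ≤ t → (∀ z → 1 ≤ z → z ≤ c → ¬ ¬ S z) →
              (∀ z → c′ ≤ z → z ≤ t → ¬ ¬ S z) → c + (t ∸ c′) ≤ r
wrap-length {r = r} {S = S} {c = c} {c′ = c′} {t = t} few c<c′ c′≤t S-head S-tail =
  s≤s⁻¹ (subst (_≤ suc r) (+-suc c (t ∸ c′))
    (segments-≤ {S = S} few c<c′ (λ i → S-head _ (s≤s z≤n) (toℕ<n i)) (range⇒segment c′≤t S-tail)))

CyclicallyInterval : ℕ → (ℕ → Set) → Set
CyclicallyInterval t S = IsInterval S ⊎ IsInterval (λ z → InRange 1 t z × ¬ S z)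

near-in-interval : HasAtMost (suc r) S → IsInterval S → S c → S c′ → c ≤ c′ → Near t r c c′
near-in-interval {c = c} {c′ = c′} few (a , b , _ , S⇔) c∈S c′∈S c≤c′ =
  near-≤ c≤c′ (segment-length few c≤c′ λ z c≤z z≤c′ ¬Sz →
    ¬Sz (proj₂ (S⇔ z) (≤-trans a≤c c≤z , ≤-trans z≤c′ c′≤b)))
  where
  a≤c : a ≤ c
  a≤c = proj₁ (proj₁ (S⇔ c) c∈S)
  c′≤b : c′ ≤ b
  c′≤b = proj₂ (proj₁ (S⇔ c′) c′∈S)

-- Either [c, c′] misses the gap [a, b] of S, or c < a ≤ b < c′ and S ⊇ [1, c] ∪ [c′, t].
near-in-co-interval : HasAtMost (suc r) S → IsInterval (λ z → InRange 1 t z × ¬ S z) →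
                      S c → S c′ → c ≤ c′ → 1 ≤ c → c′ ≤ t → Near t r c c′
near-in-co-interval {r = r} {S = S} {t = t} {c = c} {c′ = c′} few (a , b , _ , gap⇔) c∈S c′∈S c≤c′ 1≤c c′≤t =
  by-position (c′ <? a) (b <? c)
  where
  S-avoids-gap : ∀ {z} → S z → ¬ InRange a b z
  S-avoids-gap Sz z∈gap = proj₂ (proj₂ (gap⇔ _) z∈gap) Sz
  off-gap : ∀ z → 1 ≤ z → z ≤ t → ¬ InRange a b z → ¬ ¬ S z
  off-gap z 1≤z z≤t z∉gap ¬Sz = z∉gap (proj₁ (gap⇔ z) ((1≤z , z≤t) , ¬Sz))
  below-gap : ∀ {z} → z < a → ¬ InRange a b z
  below-gap z<a (a≤z , _) = <⇒≱ z<a a≤z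
  above-gap : ∀ {z} → b < z → ¬ InRange a b z
  above-gap b<z (_ , z≤b) = <⇒≱ b<z z≤b
  between : ∀ {z} → c ≤ z → z ≤ c′ → 1 ≤ z × z ≤ t
  between c≤z z≤c′ = ≤-trans 1≤c c≤z , ≤-trans z≤c′ c′≤t
  by-position : Dec (c′ < a) → Dec (b < c) → Near t r c c′
  by-position (yes c′<a) _ = near-≤ c≤c′ (segment-length few c≤c′ λ z c≤z z≤c′ →
    uncurry (off-gap z) (between c≤z z≤c′) (below-gap (≤-<-trans z≤c′ c′<a)))
  by-position (no _) (yes b<c) = near-≤ c≤c′ (segment-length few c≤c′ λ z c≤z z≤c′ →
    uncurry (off-gap z) (between c≤z z≤c′) (above-gap (<-≤-trans b<c c≤z)))
  by-position (no c′≮a) (no b≮c) = near-wrap c′≤t (wrap-length few c<c′ c′≤t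
      (λ z 1≤z z≤c → off-gap z 1≤z (≤-trans z≤c (≤-trans c≤c′ c′≤t)) (below-gap (≤-<-trans z≤c c<a)))
      (λ z c′≤z z≤t → off-gap z (≤-trans 1≤c (≤-trans c≤c′ c′≤z)) z≤t (above-gap (<-≤-trans b<c′ c′≤z))))
    where
    c<a : c < a
    c<a = ≰⇒> λ a≤c → S-avoids-gap c∈S (a≤c , ≮⇒≥ b≮c)
    b<c′ : b < c′
    b<c′ = ≰⇒> λ c′≤b → S-avoids-gap c′∈S (≮⇒≥ c′≮a , c′≤b)
    c<c′ : c < c′
    c<c′ = <-≤-trans c<a (≮⇒≥ c′≮a)

near-ordered : HasAtMost (suc r) S → CyclicallyInterval t S →
               S c → S c′ → c ≤ c′ → 1 ≤ c → c′ ≤ t → Near t r c c′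
near-ordered few (inj₁ S-interval) c∈S c′∈S c≤c′ _ _ = near-in-interval few S-interval c∈S c′∈S c≤c′
near-ordered few (inj₂ gap-interval) = near-in-co-interval few gap-interval

cyclic-near : HasAtMost (suc r) S → CyclicallyInterval t S → S c → S c′ → InRange 1 t c → InRange 1 t c′ → Near t r c c′
cyclic-near {c = c} {c′ = c′} few cyc c∈S c′∈S (1≤c , c≤t) (1≤c′ , c′≤t) with ≤-total c c′
... | inj₁ c≤c′ = near-ordered few cyc c∈S c′∈S c≤c′ 1≤c c′≤t
... | inj₂ c′≤c = near-sym (near-ordered few cyc c′∈S c∈S c′≤c 1≤c′ c≤t)

record Degree≤ (Γ : Graph) (v : V Γ) (d : ℕ) : Set where
  field
    index           : ∀ {e} → Incident Γ v e → Fin d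
    index-injective : ∀ {e e′} (i : Incident Γ v e) (i′ : Incident Γ v e′) → index i ≡ index i′ → e ≡ e′

colours-at-most : ∀ {Γ v} (φ : E Γ → ℕ) → Degree≤ Γ v d → HasAtMost d (InS Γ φ v)
colours-at-most {d = d} {Γ = Γ} {v = v} φ deg {n} g g-injective g∈S =
  decidable-stable (n ≤? d) λ n≰d → ¬¬-Π-Fin n g∈S (n≰d ∘ witnesses⇒≤)
  where
  open Degree≤ deg
  witnesses⇒≤ : (∀ i → InS Γ φ v (g i)) → n ≤ d
  witnesses⇒≤ w = injective⇒≤ {f = λ i → index (proj₁ (proj₂ (w i)))} λ {i} {j} eq → g-injective (begin
    g i               ≡⟨ proj₂ (proj₂ (w i)) ⟨
    φ (proj₁ (w i))   ≡⟨ cong φ (index-injective _ _ eq) ⟩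
    φ (proj₁ (w j))   ≡⟨ proj₂ (proj₂ (w j)) ⟩
    g j               ∎)

adjacent-colours-near : ∀ {Γ v e e′} {φ : E Γ → ℕ} → (∀ e → InRange 1 t (φ e)) → CyclicallyInterval t (InS Γ φ v) →
                        Degree≤ Γ v (suc r) → Incident Γ v e → Incident Γ v e′ → Near t r (φ e) (φ e′)
adjacent-colours-near {φ = φ} φ∈ cyc deg v∈e v∈e′ =
  cyclic-near (colours-at-most φ deg) cyc (_ , v∈e , refl) (_ , v∈e′ , refl) (φ∈ _) (φ∈ _)

module _ {m : ℕ} where

  y-incident : ∀ {p q} e → Incident (G m) (y p q) e → proj₂ (endsG m e) ≡ y p q
  y-incident (e₀ _ _)     (inj₁ ())
  y-incident (eᵢ _ _ _ _) (inj₁ ())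
  y-incident (eⱼ _ _ _ _) (inj₁ ())
  y-incident _            (inj₂ y≡) = y≡

  -- At y p q the edges e₀ p q, eᵢ p j _ q and eⱼ i p _ q are told apart by p, j and i respectively.
  y-label : EG m → Fin m
  y-label (e₀ p _)     = p
  y-label (eᵢ _ j _ _) = j
  y-label (eⱼ i _ _ _) = i

  y-label-injective : ∀ {p q} e e′ → proj₂ (endsG m e) ≡ y p q → proj₂ (endsG m e′) ≡ y p q →
                      y-label e ≡ y-label e′ → e ≡ e′
  y-label-injective (e₀ _ _)       (e₀ _ _)        refl refl _    = refl
  y-label-injective (e₀ _ _)       (eᵢ _ _ p<j _)  refl refl p≡j  = ⊥-elim (<ᶠ⇒≢ p<j p≡j)
  y-label-injective (e₀ _ _)       (eⱼ _ _ i<p _)  refl refl p≡i  = ⊥-elim (<ᶠ⇒≢ i<p (sym p≡i))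
  y-label-injective (eᵢ _ _ p<j _) (e₀ _ _)        refl refl j≡p  = ⊥-elim (<ᶠ⇒≢ p<j (sym j≡p))
  y-label-injective (eᵢ _ _ p<j _) (eᵢ _ _ p<j′ _) refl refl refl = cong (λ p<j → eᵢ _ _ p<j _) (<-irrelevant p<j p<j′)
  y-label-injective (eᵢ _ _ p<j _) (eⱼ _ _ j<p _)  refl refl refl = ⊥-elim (<ᶠ-asym p<j j<p)
  y-label-injective (eⱼ _ _ i<p _) (e₀ _ _)        refl refl i≡p  = ⊥-elim (<ᶠ⇒≢ i<p i≡p)
  y-label-injective (eⱼ _ _ i<p _) (eᵢ _ _ p<i _)  refl refl refl = ⊥-elim (<ᶠ-asym i<p p<i)
  y-label-injective (eⱼ _ _ i<p _) (eⱼ _ _ i<p′ _) refl refl refl = cong (λ i<p → eⱼ _ _ i<p _) (<-irrelevant i<p i<p′)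

  y-degree : ∀ p q → Degree≤ (G m) (y p q) m
  y-degree p q = record
    { index           = λ {e} _ → y-label e
    ; index-injective = λ {e} {e′} y∈e y∈e′ → y-label-injective e e′ (y-incident e y∈e) (y-incident e′ y∈e′)
    }

  x-incident : ∀ {i j i<j} e → Incident (G m) (x i j i<j) e → proj₁ (endsG m e) ≡ x i j i<j
  x-incident (e₀ _ _)     (inj₁ ())
  x-incident (e₀ _ _)     (inj₂ ())
  x-incident (eᵢ _ _ _ _) (inj₂ ())
  x-incident (eⱼ _ _ _ _) (inj₂ ())
  x-incident _            (inj₁ x≡) = x≡

  x-side : ∀ {i j i<j} e → proj₁ (endsG m e) ≡ x i j i<j → Fin m ⊎ Fin m
  x-side (e₀ _ _)     ()
  x-side (eᵢ _ _ _ q) _ = inj₁ q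
  x-side (eⱼ _ _ _ q) _ = inj₂ q

  x-side-injective : ∀ {i j i<j} e e′ (x≡ : proj₁ (endsG m e) ≡ x i j i<j) (x≡′ : proj₁ (endsG m e′) ≡ x i j i<j) →
                     x-side e x≡ ≡ x-side e′ x≡′ → e ≡ e′
  x-side-injective (e₀ _ _)     _            ()
  x-side-injective _            (e₀ _ _)     _    ()
  x-side-injective (eᵢ _ _ _ _) (eᵢ _ _ _ _) refl refl refl = refl
  x-side-injective (eⱼ _ _ _ _) (eⱼ _ _ _ _) refl refl refl = refl
  x-side-injective (eᵢ _ _ _ _) (eⱼ _ _ _ _) refl refl ()
  x-side-injective (eⱼ _ _ _ _) (eᵢ _ _ _ _) refl refl ()

  x-degree : ∀ i j (i<j : i <ᶠ j) → Degree≤ (G m) (x i j i<j) (m + m)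
  x-degree i j i<j = record
    { index           = λ {e} x∈e → join m m (x-side e (x-incident e x∈e))
    ; index-injective = λ {e} {e′} x∈e x∈e′ eq →
        x-side-injective e e′ (x-incident e x∈e) (x-incident e′ x∈e′) (join-injective eq)
    }
    where
    join-injective : Injective _≡_ _≡_ (join m m)
    join-injective = Injection.injective (↔⇒↣ (↔-sym +↔⊎))

-- Sum of the radii at y (degree n + 1), x (degree 2n + 2) and y again, for m = n + 1.
route-radius : ℕ → ℕ
route-radius n = n + ((n + suc n) + n)

module _ {k t : ℕ} {φ : EG (2 + k) → ℕ} (φ∈ : ∀ e → InRange 1 t (φ e))
         (cyc : ∀ v → CyclicallyInterval t (InS (G (2 + k)) φ v)) where

  near-at-y : ∀ {p q} e e′ → Incident (G (2 + k)) (y p q) e → Incident (G (2 + k)) (y p q) e′ →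
              Near t (suc k) (φ e) (φ e′)
  near-at-y _ _ = adjacent-colours-near φ∈ (cyc _) (y-degree _ _)

  near-at-x : ∀ {i j i<j} e e′ → Incident (G (2 + k)) (x i j i<j) e → Incident (G (2 + k)) (x i j i<j) e′ →
              Near t (suc k + (2 + k)) (φ e) (φ e′)
  near-at-x _ _ = adjacent-colours-near φ∈ (cyc _) (x-degree _ _ _)

  near-via : ∀ {j p q : Fin (2 + k)} (0<j : Fin.zero {suc k} <ᶠ j) e →
             Incident (G (2 + k)) (x Fin.zero j 0<j) e → Incident (G (2 + k)) (y p q) e →
             Near t (route-radius (suc k)) (φ (e₀ Fin.zero Fin.zero)) (φ (e₀ p q))
  near-via 0<j e x∈e y∈e =
    near-trans (near-at-y (e₀ _ _) (eᵢ _ _ 0<j Fin.zero) (inj₂ refl) (inj₂ refl))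
   (near-trans (near-at-x (eᵢ _ _ 0<j Fin.zero) e (inj₁ refl) x∈e)
               (near-at-y e (e₀ _ _) y∈e (inj₂ refl)))

  x₀-colours-near : ∀ p q → Near t (route-radius (suc k)) (φ (e₀ Fin.zero Fin.zero)) (φ (e₀ p q))
  x₀-colours-near Fin.zero    q = near-via (s≤s z≤n) (eᵢ _ (Fin.suc Fin.zero) _ q) (inj₁ refl) (inj₂ refl)
  x₀-colours-near (Fin.suc p) q = near-via (s≤s z≤n) (eⱼ _ (Fin.suc p) _ q) (inj₁ refl) (inj₂ refl)

spread<area : ∀ n → 8 ≤ suc n → suc (route-radius n + route-radius n) < suc n * suc n
spread<area n 8≤1+n =
  ≤-trans (subst (2 + (route-radius n + route-radius n) ≤_) (eight-times n) (m≤m+n _ 4)) (*-monoˡ-≤ (suc n) 8≤1+n)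
  where
  eight-times : ∀ n → suc (suc ((n + ((n + suc n) + n)) + (n + ((n + suc n) + n)))) + 4 ≡ 8 * suc n
  eight-times = ℕ-Solver.solve-∀

theorem1 : (m : ℕ) → 8 ≤ m → ¬ InM (G m)
theorem1 0             ()
theorem1 1             (s≤s ())
theorem1 (suc (suc k)) 8≤m (t , _ , φ , (φ∈ , proper , _) , cyc) =
  <⇒≱ (spread<area (suc k) 8≤m)
      (near-pigeonhole (φ ∘ edge) colour-injective (φ∈ ∘ edge) (uncurry (x₀-colours-near φ∈ cyc) ∘ remQuot (2 + k)))
  where
  edge : Fin ((2 + k) * (2 + k)) → EG (2 + k)
  edge = uncurry e₀ ∘ remQuot (2 + k)
  colour-injective : Injective _≡_ _≡_ (φ ∘ edge)
  colour-injective eq = remQuot-injective (e₀-injective (proper x₀ _ _ (inj₁ refl) (inj₁ refl) eq))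
    where
    e₀-injective : ∀ {p q p′ q′} → e₀ {2 + k} p q ≡ e₀ p′ q′ → (p , q) ≡ (p′ , q′)
    e₀-injective refl = refl
    remQuot-injective : Injective _≡_ _≡_ (remQuot {2 + k} (2 + k))
    remQuot-injective = Injection.injective (↔⇒↣ *↔×)
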